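{- Let $n\ge 3$. Let $\Omega$ be an $\mathbb{F}_q$-subgeometry $\mathrm{PG}(n-1,q)$ of $\mathrm{PG}(n-1,q^n)$, let $\Pi$ be an $(n-3)$-dimensional subspace of $\mathrm{PG}(n-1,q^n)$ skew from $\Omega$, and let $L$ be the proper linear set of rank $n$ in a line $\mathrm{PG}(1,q^n)$ obtained by projecting $\Omega$ from $\Pi$ onto this line. If $L$ has only points of weight $1$ and $2$, then the number of points of weight $2$ in $L$ equals the number of points of rank $2$ in $\Pi$.
   Context: A linear set is proper if it contains more than one point. The projection of $\Omega$ from $\Pi$ onto a line $\ell$ skew to $\Pi$ is the set of points $\langle P,\Pi\rangle\cap\ell$, $P\in\Omega$; it is an $\mathbb{F}_q$-linear set $L(U)$, and the weight of a point $\langle v\rangle$ is $\dim_{\mathbb{F}_q}(U\cap\langle v\rangle_{q^n})$. The rank of a point of $\mathrm{PG}(n-1,q^n)$ with respect to $\Omega$ is the least $i$ such that it lies in the $\mathbb{F}_{q^n}$-extension of an $(i-1)$-dimensional subspace of $\Omega$ (equivalently, identifying $\Omega$ with the points of rank-one maps in $\mathrm{PG}(\mathrm{End}_{\mathbb{F}_q}(\mathbb{F}_{q^n}))$, the rank of the corresponding map). -}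

module Defs where

open import Data.Nat using (ℕ; zero; suc; _^_)
open import Data.Fin using (Fin; zero; suc)
open import Data.Bool using (Bool; T)
open import Data.Product using (Σ; ∃; _×_; _,_)
open import Data.Sum using (_⊎_)
open import Relation.Binary.PropositionalEquality using (_≡_)
open import Relation.Nullary using (¬_)
open import Algebra.Structures using (IsCommutativeRing)
open import Function.Bundles using (_↔_)

-- A finite field K of order q^n together with its subfield F_q of order q,
-- the subfield given by a (Bool-valued, hence proof-irrelevant) membership test.
record FqnField (q n : ℕ) : Set₁ where
  infixl 6 _+_
  infixl 7 _*_
  field
    K          : Set
    _+_ _*_    : K → K → K
    -_         : K → K
    0# 1#      : K
    isCommRing : IsCommutativeRing _≡_ _+_ _*_ -_ 0# 1#
    0≢1        : ¬ (0# ≡ 1#)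
    inverse    : ∀ x → ¬ (x ≡ 0#) → ∃ λ y → x * y ≡ 1#
    card       : Fin (q ^ n) ↔ K
    inF        : K → Bool
    F-0        : T (inF 0#)
    F-1        : T (inF 1#)
    F-+        : ∀ x y → T (inF x) → T (inF y) → T (inF (x + y))
    F-*        : ∀ x y → T (inF x) → T (inF y) → T (inF (x * y))
    F-neg      : ∀ x → T (inF x) → T (inF (- x))
    F-inv      : ∀ x y → T (inF x) → x * y ≡ 1# → T (inF y)
    cardF      : Fin q ↔ Σ K (λ x → T (inF x))

module Geom {q n : ℕ} (𝔽 : FqnField q n) where
  open FqnField 𝔽

  -- vectors of K^n (points of PG(n-1,q^n) are nonzero vectors up to K*-scalars)
  V : Set
  V = Fin n → K

  _≋_ : V → V → Set
  u ≋ v = ∀ i → u i ≡ v i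

  zeroV : V
  zeroV _ = 0#

  _⊕_ : V → V → V
  (u ⊕ v) i = u i + v i

  _·_ : K → V → V
  (a · v) i = a * v i

  _⊖_ : V → V → V
  u ⊖ v = u ⊕ ((- 1#) · v)

  lincomb : ∀ {m} → (Fin m → K) → (Fin m → V) → V
  lincomb {zero}  c g = zeroV
  lincomb {suc m} c g = (c zero · g zero) ⊕ lincomb (λ i → c (suc i)) (λ i → g (suc i))

  Nonzero : V → Set
  Nonzero v = ¬ (v ≋ zeroV)

  Proportional : V → V → Set
  Proportional u v = ∃ λ a → ¬ (a ≡ 0#) × (u ≋ (a · v))

  InKSpan : ∀ {m} → (Fin m → V) → V → Set
  InKSpan g v = ∃ λ c → v ≋ lincomb c g

  KIndep : ∀ {m} → (Fin m → V) → Set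
  KIndep g = ∀ c → lincomb c g ≋ zeroV → ∀ i → c i ≡ 0#

  IsFq : ∀ {m} → (Fin m → K) → Set
  IsFq c = ∀ i → T (inF (c i))

  FqIndep : ∀ {m} → (Fin m → V) → Set
  FqIndep g = ∀ c → IsFq c → lincomb c g ≋ zeroV → ∀ i → c i ≡ 0#

  HasFqDim : (V → Set) → ℕ → Set
  HasFqDim S w =
    (∃ λ (g : Fin w → V) → (∀ i → S (g i)) × FqIndep g)
    × (∀ (g : Fin (suc w) → V) → (∀ i → S (g i)) → ¬ FqIndep g)

  HasCount : (V → Set) → ℕ → Set
  HasCount P k =
    ∃ λ (f : Fin k → V) →
      (∀ i → P (f i))
      × (∀ i j → Proportional (f i) (f j) → i ≡ j)
      × (∀ v → P v → ∃ λ i → Proportional v (f i))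

  -- The subgeometry Ω determined by a K-basis b of K^n:
  -- Ω = { ⟨Σ λᵢ bᵢ⟩ : λ ∈ F_q^n \ {0} }, with underlying F_q-space W.
  InW : (Fin n → V) → V → Set
  InW b v = ∃ λ c → IsFq c × (v ≋ lincomb c b)

  SkewΩ : (Fin n → V) → ∀ {m} → (Fin m → V) → Set
  SkewΩ b p = ∀ w → InW b w → Nonzero w → ¬ InKSpan p w

  Skew : ∀ {m k} → (Fin m → V) → (Fin k → V) → Set
  Skew p l = ∀ v → InKSpan p v → InKSpan l v → v ≋ zeroV

  -- u is the projection of w from ⟨p⟩ onto ⟨l⟩: u ∈ ℓ and ⟨w,Π⟩ ∩ ℓ ∋ u
  ProjOf : ∀ {m} → (Fin m → V) → (Fin 2 → V) → V → V → Set
  ProjOf p l w u = InKSpan l u × InKSpan p (w ⊖ u)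

  -- the F_q-subspace U of ℓ defining the projected linear set L = L(U)
  InU : (Fin n → V) → ∀ {m} → (Fin m → V) → (Fin 2 → V) → V → Set
  InU b p l u = ∃ λ w → InW b w × ProjOf p l w u

  UonPoint : (Fin n → V) → ∀ {m} → (Fin m → V) → (Fin 2 → V) → V → V → Set
  UonPoint b p l x u = InU b p l u × ∃ λ a → u ≋ (a · x)

  Weight : (Fin n → V) → ∀ {m} → (Fin m → V) → (Fin 2 → V) → V → ℕ → Set
  Weight b p l x w = HasFqDim (UonPoint b p l x) w

  PointOfL : (Fin n → V) → ∀ {m} → (Fin m → V) → (Fin 2 → V) → V → Set
  PointOfL b p l x =
    InKSpan l x × Nonzero x × (∃ λ u → UonPoint b p l x u × Nonzero u)

  ProperL : (Fin n → V) → ∀ {m} → (Fin m → V) → (Fin 2 → V) → Set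
  ProperL b p l = ∃ λ x → ∃ λ y →
    PointOfL b p l x × PointOfL b p l y × ¬ Proportional x y

  OnlyWeights12 : (Fin n → V) → ∀ {m} → (Fin m → V) → (Fin 2 → V) → Set
  OnlyWeights12 b p l = ∀ x → PointOfL b p l x → Weight b p l x 1 ⊎ Weight b p l x 2

  Weight2Point : (Fin n → V) → ∀ {m} → (Fin m → V) → (Fin 2 → V) → V → Set
  Weight2Point b p l x = InKSpan l x × Nonzero x × Weight b p l x 2

  -- ⟨v⟩ lies in the K-extension of a subspace of Ω spanned by i of its points
  RankLE : (Fin n → V) → ℕ → V → Set
  RankLE b i v = ∃ λ (w : Fin i → V) → (∀ j → InW b (w j)) × InKSpan w v

  Rank2 : (Fin n → V) → V → Set
  Rank2 b v = RankLE b 2 v × ¬ RankLE b 1 v × ¬ RankLE b 0 v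

  Rank2PointOfΠ : (Fin n → V) → ∀ {m} → (Fin m → V) → V → Set
  Rank2PointOfΠ b p v = InKSpan p v × Nonzero v × Rank2 b v

-- Let W be the F_q-span of Ω and U ⊆ ℓ its image under the projection along Π, so that
-- K^n = ℓ ⊕ Π and W ∩ Π = 0 make W → U injective. If ⟨x⟩ has weight 2, U ∩ ⟨x⟩ contains
-- F_q-independent a₀x, a₁x whose preimages w₀, w₁ ∈ W are K-independent, and a₁w₀ − a₀w₁ is a
-- point of Π of rank 2. Conversely a rank-2 point αw₀ + βw₁ of Π projects w₀ and w₁ onto two
-- F_q-independent vectors of U on one point of ℓ, which therefore has weight 2. Both maps send
-- distinct points to distinct points (the second because no weight exceeds 2), so the two
-- sets are equinumerous.
module Submission where

open import Defs
open import Level using (Level; 0ℓ)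
open import Data.Nat using (ℕ; zero; suc; _≤_; _<_; _∸_; s≤s)
import Data.Nat as ℕ
open import Data.Nat.Properties using (≤-antisym; m≤n+m∸n)
import Data.Fin as Fin
open import Data.Fin using (Fin; zero; suc; punchIn; punchOut)
open import Data.Fin.Properties using (all?; ¬∀⟶∃¬; punchIn-punchOut; injective⇒≤)
open import Data.Vec.Functional using (_∷_; []; tail)
open import Data.Bool using (T)
open import Data.Product using (∃; _×_; _,_; proj₁; proj₂)
open import Data.Sum using ([_,_]′)
open import Data.Maybe using (Maybe; just; nothing)
open import Data.Empty using (⊥-elim)
open import Function using (id)
open import Relation.Nullary using (¬_; Dec; yes; no)
open import Relation.Nullary.Decidable using (via-injection)
open import Relation.Binary.Definitions using (DecidableEquality)
open import Relation.Binary.PropositionalEquality using (_≡_)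
open import Algebra.Bundles using (CommutativeRing; RawRing)
open import Function.Properties.Inverse using (↔⇒↣; ↔-sym)
import Algebra.Solver.Ring.AlmostCommutativeRing as Coefficients
import Tactic.RingSolver.Core.AlmostCommutativeRing as Tactic
import Tactic.RingSolver.NonReflective as NonReflective
import Algebra.Properties.Semiring.Mult as SemiringMult
import Algebra.Properties.Ring as RingProperties
import Algebra.Properties.Semiring.Sum as SemiringSum

-- Tactic.RingSolver takes its coefficients from the ring itself, so it cannot cancel x − x;
-- with integer coefficients the normal forms of both sides agree on the nose.
module IntegerCoefficientRingSolver {c ℓ : Level} (R : CommutativeRing c ℓ) where
  open CommutativeRing R
  open SemiringMult semiring using (×-homo-+; ×1-homo-*) renaming (_×_ to _×ₙ_)
  open RingProperties ring using (-‿+-comm; -‿involutive; -0#≈0#; -‿distribˡ-*; -‿distribʳ-*)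
  open import Relation.Binary.Reasoning.Setoid setoid
  open import Relation.Binary.PropositionalEquality using () renaming (cong to ≡-cong)
  open NonReflective (Tactic.fromCommutativeRing R (λ _ → nothing)) using (solve; _⊕_; _⊗_; ⊝_; _⊜_)

  -- a pair (a , b) of naturals stands for the integer a − b
  ℕ²-ring : RawRing _ _
  ℕ²-ring = record
    { Carrier = ℕ × ℕ ; _≈_ = _≡_
    ; _+_ = λ { (a , b) (c , d) → (a ℕ.+ c , b ℕ.+ d) }
    ; _*_ = λ { (a , b) (c , d) → (a ℕ.* c ℕ.+ b ℕ.* d , a ℕ.* d ℕ.+ b ℕ.* c) }
    ; -_  = λ { (a , b) → (b , a) }
    ; 0#  = (0 , 0) ; 1# = (1 , 0) }

  private
    ⟦_⟧ : ℕ × ℕ → Carrier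
    ⟦ a , b ⟧ = a ×ₙ 1# - b ×ₙ 1#

    +-homo : ∀ a b c d → ⟦ a ℕ.+ c , b ℕ.+ d ⟧ ≈ ⟦ a , b ⟧ + ⟦ c , d ⟧
    +-homo a b c d = begin
      (a ℕ.+ c) ×ₙ 1# - (b ℕ.+ d) ×ₙ 1#  ≈⟨ +-cong (×-homo-+ 1# a c) (-‿cong (×-homo-+ 1# b d)) ⟩
      (A + C) - (B + D)
        ≈⟨ solve 4 (λ A B C D → ((A ⊕ C) ⊕ ⊝ (B ⊕ D)) ⊜ ((A ⊕ ⊝ B) ⊕ (C ⊕ ⊝ D))) refl A B C D ⟩
      (A - B) + (C - D)                  ∎
      where
        A B C D : Carrier
        A = a ×ₙ 1#
        B = b ×ₙ 1#
        C = c ×ₙ 1#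
        D = d ×ₙ 1#

    -- the solver over R itself cannot see (−1)(−1) = 1, so −b and −d enter as atoms
    *-homo : ∀ a b c d → ⟦ a ℕ.* c ℕ.+ b ℕ.* d , a ℕ.* d ℕ.+ b ℕ.* c ⟧ ≈ ⟦ a , b ⟧ * ⟦ c , d ⟧
    *-homo a b c d = begin
      (a ℕ.* c ℕ.+ b ℕ.* d) ×ₙ 1# - (a ℕ.* d ℕ.+ b ℕ.* c) ×ₙ 1#
        ≈⟨ +-cong (trans (×-homo-+ 1# (a ℕ.* c) (b ℕ.* d)) (+-cong (×1-homo-* a c) (×1-homo-* b d)))
                  (-‿cong (trans (×-homo-+ 1# (a ℕ.* d) (b ℕ.* c)) (+-cong (×1-homo-* a d) (×1-homo-* b c)))) ⟩
      (A * C + B * D) - (A * D + B * C)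
        ≈⟨ +-cong (+-congˡ (sym (trans (sym (-‿distribˡ-* B (- D))) (trans (-‿cong (sym (-‿distribʳ-* B D))) (-‿involutive _)))))
                  (trans (sym (-‿+-comm _ _)) (+-cong (-‿distribʳ-* A D) (-‿distribˡ-* B C))) ⟩
      (A * C + - B * - D) + (A * - D + - B * C)
        ≈⟨ solve 4 (λ A C nB nD → ((A ⊗ C ⊕ nB ⊗ nD) ⊕ (A ⊗ nD ⊕ nB ⊗ C)) ⊜ ((A ⊕ nB) ⊗ (C ⊕ nD)))
                 refl A C (- B) (- D) ⟩
      (A - B) * (C - D) ∎
      where
        A B C D : Carrier
        A = a ×ₙ 1#
        B = b ×ₙ 1#
        C = c ×ₙ 1#
        D = d ×ₙ 1#

    embedding : ℕ²-ring Coefficients.-Raw-AlmostCommutative⟶ Coefficients.fromCommutativeRing R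
    embedding = record
      { ⟦_⟧    = ⟦_⟧
      ; +-homo = λ { (a , b) (c , d) → +-homo a b c d }
      ; *-homo = λ { (a , b) (c , d) → *-homo a b c d }
      ; -‿homo = λ { (a , b) → sym (trans (sym (-‿+-comm _ _)) (trans (+-congˡ (-‿involutive _)) (+-comm _ _))) }
      ; 0-homo = trans (+-identityˡ _) -0#≈0#
      ; 1-homo = trans (+-cong (+-identityʳ 1#) -0#≈0#) (+-identityʳ 1#)
      }

    decide : ∀ x y → Maybe (⟦ x ⟧ ≈ ⟦ y ⟧)
    decide (a , b) (c , d) with a ℕ.+ d ℕ.≟ c ℕ.+ b
    ... | no _  = nothing
    ... | yes e = just (begin
      A - B                ≈⟨ sym (trans (+-congˡ (-‿inverseʳ D)) (+-identityʳ _)) ⟩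
      (A - B) + (D - D)    ≈⟨ solve 4 (λ A nB D nD → ((A ⊕ nB) ⊕ (D ⊕ nD)) ⊜ ((A ⊕ D) ⊕ (nB ⊕ nD))) refl A (- B) D (- D) ⟩
      (A + D) + (- B - D)  ≈⟨ +-congʳ (trans (sym (×-homo-+ 1# a d)) (trans (reflexive (≡-cong (_×ₙ 1#) e)) (×-homo-+ 1# c b))) ⟩
      (C + B) + (- B - D)  ≈⟨ solve 4 (λ C B nB nD → ((C ⊕ B) ⊕ (nB ⊕ nD)) ⊜ ((C ⊕ nD) ⊕ (B ⊕ nB))) refl C B (- B) (- D) ⟩
      (C - D) + (B - B)    ≈⟨ trans (+-congˡ (-‿inverseʳ B)) (+-identityʳ _) ⟩
      C - D ∎)
      where
        A B C D : Carrier
        A = a ×ₙ 1#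
        B = b ×ₙ 1#
        C = c ×ₙ 1#
        D = d ×ₙ 1#

  open import Algebra.Solver.Ring ℕ²-ring (Coefficients.fromCommutativeRing R) embedding decide public

open import Relation.Binary.PropositionalEquality using (refl; sym; trans; cong; cong₂; subst; module ≡-Reasoning)

module FieldFacts {q n : ℕ} (𝔽 : FqnField q n) where
  open FqnField 𝔽

  commutativeRing : CommutativeRing 0ℓ 0ℓ
  commutativeRing = record { isCommutativeRing = isCommRing }

  open CommutativeRing commutativeRing public
    using (+-comm; +-assoc; *-comm; *-assoc; +-identityˡ; +-identityʳ; *-identityˡ; *-identityʳ;
           zeroˡ; zeroʳ; -‿inverseˡ; -‿inverseʳ; semiring; ring)
  open RingProperties ring public using (-1*x≈-x; -0#≈0#; -‿involutive)
  open SemiringSum semiring public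
    using (sum; sum-cong-≋; sum-replicate-zero; ∑-distrib-+; ∑-comm; *-distribˡ-sum; *-distribʳ-sum)
  open IntegerCoefficientRingSolver commutativeRing public using (solve; _:=_; _:+_; _:*_; :-_; _:-_)

  _≟_ : DecidableEquality K
  _≟_ = via-injection (↔⇒↣ (↔-sym card)) Fin._≟_

  _≢0 : K → Set
  x ≢0 = ¬ (x ≡ 0#)

  1≢0 : 1# ≢0
  1≢0 e = 0≢1 (sym e)

  inv : (x : K) → x ≢0 → K
  inv x x≢0 = proj₁ (inverse x x≢0)

  *-inverseʳ : (x : K) (x≢0 : x ≢0) → x * inv x x≢0 ≡ 1#
  *-inverseʳ x x≢0 = proj₂ (inverse x x≢0)

  *-inverseˡ : (x : K) (x≢0 : x ≢0) → inv x x≢0 * x ≡ 1#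
  *-inverseˡ x x≢0 = trans (*-comm _ _) (*-inverseʳ x x≢0)

  inv-cancelˡ : (x : K) (x≢0 : x ≢0) (y : K) → inv x x≢0 * (x * y) ≡ y
  inv-cancelˡ x x≢0 y = begin
    inv x x≢0 * (x * y)  ≡⟨ *-assoc _ _ _ ⟨
    (inv x x≢0 * x) * y  ≡⟨ cong (_* y) (*-inverseˡ x x≢0) ⟩
    1# * y               ≡⟨ *-identityˡ y ⟩
    y                    ∎
    where open ≡-Reasoning

  x*y≡0⇒y≡0 : ∀ {x y} → x ≢0 → x * y ≡ 0# → y ≡ 0#
  x*y≡0⇒y≡0 {x} {y} x≢0 xy≡0 = trans (sym (inv-cancelˡ x x≢0 y)) (trans (cong (inv x x≢0 *_) xy≡0) (zeroʳ _))

  x*y≢0 : ∀ {x y} → x ≢0 → y ≢0 → (x * y) ≢0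
  x*y≢0 x≢0 y≢0 xy≡0 = y≢0 (x*y≡0⇒y≡0 x≢0 xy≡0)

  inv≢0 : (x : K) (x≢0 : x ≢0) → inv x x≢0 ≢0
  inv≢0 x x≢0 e = 1≢0 (trans (sym (*-inverseʳ x x≢0)) (trans (cong (x *_) e) (zeroʳ x)))

  -‿≢0 : ∀ {x} → x ≢0 → (- x) ≢0
  -‿≢0 {x} x≢0 e = x≢0 (trans (sym (-‿involutive x)) (trans (cong -_ e) -0#≈0#))

  a*x+b*y≡0⇒x≡-a⁻¹b*y : ∀ {a b x y} (a≢0 : a ≢0) → a * x + b * y ≡ 0# → x ≡ (- (inv a a≢0 * b)) * y
  a*x+b*y≡0⇒x≡-a⁻¹b*y {a} {b} {x} {y} a≢0 e = begin
    x                                          ≡⟨ inv-cancelˡ a a≢0 x ⟨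
    a⁻¹ * (a * x)
      ≡⟨ solve 5 (λ a⁻¹ a b x y → a⁻¹ :* (a :* x) := a⁻¹ :* (a :* x :+ b :* y) :+ (:- (a⁻¹ :* b)) :* y) refl a⁻¹ a b x y ⟩
    a⁻¹ * (a * x + b * y) + (- (a⁻¹ * b)) * y  ≡⟨ cong (λ z → a⁻¹ * z + (- (a⁻¹ * b)) * y) e ⟩
    a⁻¹ * 0# + (- (a⁻¹ * b)) * y               ≡⟨ cong (_+ (- (a⁻¹ * b)) * y) (zeroʳ a⁻¹) ⟩
    0# + (- (a⁻¹ * b)) * y                     ≡⟨ +-identityˡ _ ⟩
    (- (a⁻¹ * b)) * y                          ∎
    where open ≡-Reasoning
          a⁻¹ = inv a a≢0

  x+y≡0⇒x≡-y : ∀ {x y} → x + y ≡ 0# → x ≡ - y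
  x+y≡0⇒x≡-y {x} {y} e = begin
    x              ≡⟨ solve 2 (λ x y → x := (x :+ y) :+ :- y) refl x y ⟩
    (x + y) + - y  ≡⟨ cong (_+ - y) e ⟩
    0# + - y       ≡⟨ +-identityˡ _ ⟩
    - y            ∎
    where open ≡-Reasoning

  a*x+y≡0⇒x≡-a⁻¹*y : ∀ {a x y} (a≢0 : a ≢0) → a * x + y ≡ 0# → x ≡ (- inv a a≢0) * y
  a*x+y≡0⇒x≡-a⁻¹*y {a} {x} {y} a≢0 e = begin
    x                                 ≡⟨ a*x+b*y≡0⇒x≡-a⁻¹b*y a≢0 (trans (cong (a * x +_) (*-identityˡ y)) e) ⟩
    (- (inv a a≢0 * 1#)) * y          ≡⟨ cong (λ z → (- z) * y) (*-identityʳ _) ⟩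
    (- inv a a≢0) * y                 ∎
    where open ≡-Reasoning

  sum-zero : ∀ {m} {f : Fin m → K} → (∀ i → f i ≡ 0#) → sum f ≡ 0#
  sum-zero {m} f≡0 = trans (sum-cong-≋ f≡0) (sum-replicate-zero m)

  sum-neg : ∀ {m} (f : Fin m → K) → sum (λ i → - f i) ≡ - sum f
  sum-neg f = begin
    sum (λ i → - f i)       ≡⟨ sum-cong-≋ (λ i → sym (-1*x≈-x (f i))) ⟩
    sum (λ i → - 1# * f i)  ≡⟨ *-distribˡ-sum (- 1#) f ⟨
    - 1# * sum f            ≡⟨ -1*x≈-x (sum f) ⟩
    - sum f                 ∎
    where open ≡-Reasoning

  sum-inF : ∀ {m} (f : Fin m → K) → (∀ i → T (inF (f i))) → T (inF (sum f))
  sum-inF {zero}  f f∈F = F-0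
  sum-inF {suc m} f f∈F = F-+ _ _ (f∈F zero) (sum-inF (λ i → f (suc i)) (λ i → f∈F (suc i)))

  nonzero-entry : ∀ {d} (v : Fin d → K) → ¬ (∀ j → v j ≡ 0#) → ∃ λ j → v j ≢0
  nonzero-entry {d} v = ¬∀⟶∃¬ d (λ j → v j ≡ 0#) (λ j → v j ≟ 0#)

module GaussianElimination {q n : ℕ} (𝔽 : FqnField q n) where
  open FqnField 𝔽
  open FieldFacts 𝔽
  open Geom 𝔽 using (IsFq)

  Rows : ℕ → ℕ → Set
  Rows m d = Fin m → Fin d → K

  combination : ∀ {m d} → (Fin m → K) → Rows m d → Fin d → K
  combination a h c = sum (λ k → a k * h k c)

  IsRelation : ∀ {m d} → Rows m d → (Fin m → K) → Set
  IsRelation h a = ∀ c → combination a h c ≡ 0#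

  module Pivot {m d} (h : Rows (suc m) d) (j : Fin d) (pivot≢0 : h zero j ≢0) where

    ratio : Fin m → K
    ratio i = h (suc i) j * inv (h zero j) pivot≢0

    reduced : Rows m d
    reduced i c = h (suc i) c + - (ratio i * h zero c)

    reduced-pivot : ∀ i → reduced i j ≡ 0#
    reduced-pivot i = begin
      h (suc i) j + - ((h (suc i) j * inv (h zero j) pivot≢0) * h zero j)
        ≡⟨ cong (λ z → h (suc i) j + - z) (trans (*-assoc _ _ _) (cong (h (suc i) j *_) (*-inverseˡ _ pivot≢0))) ⟩
      h (suc i) j + - (h (suc i) j * 1#)  ≡⟨ trans (cong (λ z → h (suc i) j + - z) (*-identityʳ _)) (-‿inverseʳ _) ⟩
      0#                                  ∎
      where open ≡-Reasoning

    residue : (Fin (suc m) → K) → K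
    residue a = a zero + sum (λ i → a (suc i) * ratio i)

    combination-reduced : ∀ a c → combination a h c ≡ combination (tail a) reduced c + residue a * h zero c
    combination-reduced a c = begin
      a zero * h zero c + A
        ≡⟨ solve 4 (λ a₀ h₀ A B → a₀ :* h₀ :+ A := (A :+ (:- B) :* h₀) :+ (a₀ :+ B) :* h₀) refl (a zero) (h zero c) A B ⟩
      (A + (- B) * h zero c) + (a zero + B) * h zero c     ≡⟨ cong (_+ (a zero + B) * h zero c) reduced-sum ⟨
      combination (tail a) reduced c + residue a * h zero c ∎
      where
        open ≡-Reasoning
        A = sum (λ i → a (suc i) * h (suc i) c)
        B = sum (λ i → a (suc i) * ratio i)
        reduced-sum : combination (tail a) reduced c ≡ A + (- B) * h zero c
        reduced-sum = begin
          sum (λ i → a (suc i) * (h (suc i) c + - (ratio i * h zero c)))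
            ≡⟨ sum-cong-≋ (λ i → solve 4 (λ x y z w → x :* (y :+ :- (z :* w)) := x :* y :+ (:- (x :* z)) :* w) refl
                                         (a (suc i)) (h (suc i) c) (ratio i) (h zero c)) ⟩
          sum (λ i → a (suc i) * h (suc i) c + (- (a (suc i) * ratio i)) * h zero c)
            ≡⟨ ∑-distrib-+ (λ i → a (suc i) * h (suc i) c) (λ i → (- (a (suc i) * ratio i)) * h zero c) ⟩
          A + sum (λ i → (- (a (suc i) * ratio i)) * h zero c)
            ≡⟨ cong (A +_) (*-distribʳ-sum (h zero c) (λ i → - (a (suc i) * ratio i))) ⟨
          A + sum (λ i → - (a (suc i) * ratio i)) * h zero c
            ≡⟨ cong (λ z → A + z * h zero c) (sum-neg (λ i → a (suc i) * ratio i)) ⟩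
          A + (- B) * h zero c ∎

    extend : (Fin m → K) → Fin (suc m) → K
    extend a = (- sum (λ i → a i * ratio i)) ∷ a

    residue-extend : ∀ a → residue (extend a) ≡ 0#
    residue-extend a = -‿inverseˡ _

    extend-relation : ∀ {a} → IsRelation reduced a → IsRelation h (extend a)
    extend-relation {a} rel c = begin
      combination (extend a) h c                     ≡⟨ combination-reduced (extend a) c ⟩
      combination a reduced c + residue (extend a) * h zero c ≡⟨ cong₂ (λ x y → x + y * h zero c) (rel c) (residue-extend a) ⟩
      0# + 0# * h zero c                            ≡⟨ trans (+-identityˡ _) (zeroˡ _) ⟩
      0#                                             ∎
      where open ≡-Reasoning

  unit : ∀ {m} → Fin m → Fin m → K
  unit zero    = 1# ∷ λ _ → 0#
  unit (suc i) = 0# ∷ unit i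

  unit-IsFq : ∀ {m} (i : Fin m) → IsFq (unit i)
  unit-IsFq zero    zero    = F-1
  unit-IsFq zero    (suc _) = F-0
  unit-IsFq (suc i) zero    = F-0
  unit-IsFq (suc i) (suc j) = unit-IsFq i j

  unit-diagonal : ∀ {m} (i : Fin m) → unit i i ≡ 1#
  unit-diagonal zero    = refl
  unit-diagonal (suc i) = unit-diagonal i

  zero-row⇒relation : ∀ {m d} (h : Rows (suc m) d) → (∀ c → h zero c ≡ 0#) → IsRelation h (unit zero)
  zero-row⇒relation h row₀≡0 c =
    trans (cong₂ _+_ (trans (cong (1# *_) (row₀≡0 c)) (zeroʳ _)) (sum-zero (λ i → zeroˡ (h (suc i) c)))) (+-identityˡ 0#)

  more-rows-than-columns⇒dependent : ∀ {m d} → d < m → (h : Rows m d) →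
                                     ∃ λ a → (∃ λ k → a k ≢0) × IsRelation h a
  more-rows-than-columns⇒dependent {suc m} {d} d<m h with all? (λ c → h zero c ≟ 0#)
  ... | yes row₀≡0 = unit zero , (zero , 1≢0) , zero-row⇒relation h row₀≡0
  ... | no row₀≢0 with nonzero-entry (h zero) row₀≢0
  more-rows-than-columns⇒dependent {suc m} {suc d} (s≤s d<m) h | no _ | j , pivot≢0 =
    extend-dependency (more-rows-than-columns⇒dependent d<m (λ i c → reduced i (punchIn j c)))
    where
      open Pivot h j pivot≢0
      extend-dependency : (∃ λ a → (∃ λ k → a k ≢0) × IsRelation (λ i c → reduced i (punchIn j c)) a) →
                          ∃ λ a → (∃ λ k → a k ≢0) × IsRelation h a
      extend-dependency (a , (k , a≢0) , rel) = extend a , (suc k , a≢0) , extend-relation reduced-relation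
        where
          reduced-relation : IsRelation reduced a
          reduced-relation c with j Fin.≟ c
          ... | yes refl = sum-zero (λ i → trans (cong (a i *_) (reduced-pivot i)) (zeroʳ _))
          ... | no j≢c   = subst (λ c → combination a reduced c ≡ 0#) (punchIn-punchOut j≢c) (rel (punchOut j≢c))

  FqIndependentRows : ∀ {m d} → Rows m d → Set
  FqIndependentRows h = ∀ f → IsFq f → IsRelation h f → ∀ k → f k ≡ 0#

  KIndependentRows : ∀ {m d} → Rows m d → Set
  KIndependentRows h = ∀ a → IsRelation h a → ∀ k → a k ≡ 0#

  Fq-rows-independent⇒K-independent : ∀ {m d} (h : Rows m d) → (∀ i → IsFq (h i)) →
                                      FqIndependentRows h → KIndependentRows h
  Fq-rows-independent⇒K-independent {zero} h h∈F h-indep a rel ()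
  Fq-rows-independent⇒K-independent {suc m} h h∈F h-indep a rel = at-pivot (nonzero-entry (h zero) row₀≢0)
    where
      row₀≢0 : ¬ (∀ c → h zero c ≡ 0#)
      row₀≢0 row₀≡0 = 1≢0 (h-indep (unit zero) (unit-IsFq zero) (zero-row⇒relation h row₀≡0) zero)
      at-pivot : (∃ λ j → h zero j ≢0) → ∀ k → a k ≡ 0#
      at-pivot (j , pivot≢0) = a≡0
        where
          open Pivot h j pivot≢0
          ratio∈F : IsFq ratio
          ratio∈F i = F-* _ _ (h∈F (suc i) j) (F-inv _ _ (h∈F zero j) (*-inverseʳ _ pivot≢0))
          reduced∈F : ∀ i → IsFq (reduced i)
          reduced∈F i c = F-+ _ _ (h∈F (suc i) c) (F-neg _ (F-* _ _ (ratio∈F i) (h∈F zero c)))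
          reduced-indep : FqIndependentRows reduced
          reduced-indep f f∈F f-rel i = h-indep (extend f) extend∈F (extend-relation f-rel) (suc i)
            where
              extend∈F : IsFq (extend f)
              extend∈F zero    = F-neg _ (sum-inF _ (λ i → F-* _ _ (f∈F i) (ratio∈F i)))
              extend∈F (suc i) = f∈F i
          -- evaluating the relation at the pivot column kills the reduced rows
          residue≡0 : residue a ≡ 0#
          residue≡0 = x*y≡0⇒y≡0 pivot≢0 (begin
            h zero j * residue a                                   ≡⟨ *-comm _ _ ⟩
            residue a * h zero j                                   ≡⟨ +-identityˡ _ ⟨
            0# + residue a * h zero j                              ≡⟨ cong (_+ residue a * h zero j) reduced-column≡0 ⟨
            combination (tail a) reduced j + residue a * h zero j  ≡⟨ combination-reduced a j ⟨
            combination a h j                                      ≡⟨ rel j ⟩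
            0#                                                     ∎)
            where
              open ≡-Reasoning
              reduced-column≡0 : combination (tail a) reduced j ≡ 0#
              reduced-column≡0 = sum-zero (λ i → trans (cong (a (suc i) *_) (reduced-pivot i)) (zeroʳ _))
          tail-relation : IsRelation reduced (tail a)
          tail-relation c = begin
            combination (tail a) reduced c                         ≡⟨ +-identityʳ _ ⟨
            combination (tail a) reduced c + 0#                    ≡⟨ cong (combination (tail a) reduced c +_) residue-term≡0 ⟨
            combination (tail a) reduced c + residue a * h zero c  ≡⟨ combination-reduced a c ⟨
            combination a h c                                      ≡⟨ rel c ⟩
            0#                                                     ∎
            where
              open ≡-Reasoning
              residue-term≡0 : residue a * h zero c ≡ 0#
              residue-term≡0 = trans (cong (_* h zero c) residue≡0) (zeroˡ _)
          tail≡0 : ∀ i → a (suc i) ≡ 0#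
          tail≡0 = Fq-rows-independent⇒K-independent reduced reduced∈F reduced-indep (tail a) tail-relation
          a≡0 : ∀ k → a k ≡ 0#
          a≡0 zero    = trans (sym (trans (cong (a zero +_) (sum-zero (λ i → trans (cong (_* ratio i) (tail≡0 i)) (zeroˡ _))))
                                          (+-identityʳ _)))
                              residue≡0
          a≡0 (suc i) = tail≡0 i

module Vectors {q n : ℕ} (𝔽 : FqnField q n) where
  open FqnField 𝔽
  open Geom 𝔽
  open FieldFacts 𝔽
  open GaussianElimination 𝔽

  lincomb-coordinate : ∀ {k} (c : Fin k → K) (g : Fin k → V) j → lincomb c g j ≡ combination c g j
  lincomb-coordinate {zero}  c g j = refl
  lincomb-coordinate {suc k} c g j = cong (c zero * g zero j +_) (lincomb-coordinate (tail c) (tail g) j)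

  lincomb-cong : ∀ {k} (f : Fin k → K) {u v : Fin k → V} → (∀ i → u i ≋ v i) → lincomb f u ≋ lincomb f v
  lincomb-cong {zero}  f u≋v j = refl
  lincomb-cong {suc k} f u≋v j = cong₂ (λ x y → f zero * x + y) (u≋v zero j) (lincomb-cong (tail f) (λ i → u≋v (suc i)) j)

  lincomb-zeros : ∀ {k} {c : Fin k → K} (g : Fin k → V) → (∀ i → c i ≡ 0#) → lincomb c g ≋ zeroV
  lincomb-zeros {c = c} g c≡0 j = trans (lincomb-coordinate c g j) (sum-zero (λ i → trans (cong (_* g i j) (c≡0 i)) (zeroˡ _)))

  lincomb-⊕ : ∀ {k} (f : Fin k → K) (u v : Fin k → V) → lincomb f (λ i → u i ⊕ v i) ≋ (lincomb f u ⊕ lincomb f v)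
  lincomb-⊕ {zero}  f u v j = sym (+-identityˡ 0#)
  lincomb-⊕ {suc k} f u v j = trans (cong (f zero * (u zero j + v zero j) +_) (lincomb-⊕ (tail f) (tail u) (tail v) j))
    (solve 5 (λ f a b x y → f :* (a :+ b) :+ (x :+ y) := (f :* a :+ x) :+ (f :* b :+ y)) refl
             (f zero) (u zero j) (v zero j) (lincomb (tail f) (tail u) j) (lincomb (tail f) (tail v) j))

  lincomb-lincomb : ∀ {k m} (f : Fin k → K) (c : Fin k → Fin m → K) (g : Fin m → V) →
                    lincomb f (λ i → lincomb (c i) g) ≋ lincomb (combination f c) g
  lincomb-lincomb f c g x = begin
    lincomb f (λ i → lincomb (c i) g) x
      ≡⟨ lincomb-coordinate f _ x ⟩
    sum (λ i → f i * lincomb (c i) g x)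
      ≡⟨ sum-cong-≋ (λ i → cong (f i *_) (lincomb-coordinate (c i) g x)) ⟩
    sum (λ i → f i * sum (λ j → c i j * g j x))
      ≡⟨ sum-cong-≋ (λ i → *-distribˡ-sum (f i) (λ j → c i j * g j x)) ⟩
    sum (λ i → sum (λ j → f i * (c i j * g j x)))
      ≡⟨ ∑-comm (λ i j → f i * (c i j * g j x)) ⟩
    sum (λ j → sum (λ i → f i * (c i j * g j x)))
      ≡⟨ sum-cong-≋ (λ j → sum-cong-≋ (λ i → sym (*-assoc (f i) (c i j) (g j x)))) ⟩
    sum (λ j → sum (λ i → (f i * c i j) * g j x))
      ≡⟨ sum-cong-≋ (λ j → *-distribʳ-sum (g j x) (λ i → f i * c i j)) ⟨
    sum (λ j → combination f c j * g j x)
      ≡⟨ lincomb-coordinate (combination f c) g x ⟨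
    lincomb (combination f c) g x
      ∎
    where open ≡-Reasoning

  lincomb₂ : (c : Fin 2 → K) (g : Fin 2 → V) → lincomb c g ≋ ((c zero · g zero) ⊕ (c (suc zero) · g (suc zero)))
  lincomb₂ c g j = cong (c zero * g zero j +_) (+-identityʳ _)

  lincomb-unit : ∀ {k} (i : Fin k) (g : Fin k → V) → lincomb (unit i) g ≋ g i
  lincomb-unit zero    g j = trans (cong₂ _+_ (*-identityˡ _) (lincomb-zeros (tail g) (λ _ → refl) j)) (+-identityʳ _)
  lincomb-unit (suc i) g j = trans (cong₂ _+_ (zeroˡ _) (lincomb-unit i (tail g) j)) (+-identityˡ _)

  lincomb-on-point : ∀ {k} {x : V} (f a : Fin k → K) {g : Fin k → V} → (∀ i → g i ≋ (a i · x)) →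
                     lincomb f g ≋ (sum (λ i → f i * a i) · x)
  lincomb-on-point {x = x} f a {g} g≋ax j = begin
    lincomb f g j                     ≡⟨ lincomb-coordinate f g j ⟩
    sum (λ i → f i * g i j)           ≡⟨ sum-cong-≋ (λ i → trans (cong (f i *_) (g≋ax i j)) (sym (*-assoc _ _ _))) ⟩
    sum (λ i → (f i * a i) * x j)     ≡⟨ *-distribʳ-sum (x j) (λ i → f i * a i) ⟨
    sum (λ i → f i * a i) * x j       ∎
    where open ≡-Reasoning

  InKSpan-resp : ∀ {k} {g : Fin k → V} {u v} → u ≋ v → InKSpan g v → InKSpan g u
  InKSpan-resp u≋v (c , v≋) = c , (λ j → trans (u≋v j) (v≋ j))

  InKSpan-self : ∀ {k} (c : Fin k → K) (g : Fin k → V) → InKSpan g (lincomb c g)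
  InKSpan-self c g = c , (λ j → refl)

  InKSpan-zero : ∀ {k} (g : Fin k → V) → InKSpan g zeroV
  InKSpan-zero g = (λ _ → 0#) , (λ j → sym (lincomb-zeros g (λ _ → refl) j))

  InKSpan-lincomb : ∀ {k m} {g : Fin m → V} (f : Fin k → K) {u : Fin k → V} →
                    (∀ i → InKSpan g (u i)) → InKSpan g (lincomb f u)
  InKSpan-lincomb {g = g} f u∈ = combination f (λ i → proj₁ (u∈ i)) ,
    (λ x → trans (lincomb-cong f (λ i → proj₂ (u∈ i)) x) (lincomb-lincomb f (λ i → proj₁ (u∈ i)) g x))

  InKSpan-+ : ∀ {k} {g : Fin k → V} {u v} α β → InKSpan g u → InKSpan g v → InKSpan g ((α · u) ⊕ (β · v))
  InKSpan-+ {u = u} {v} α β u∈ v∈ = InKSpan-resp (λ j → cong (α * u j +_) (sym (+-identityʳ (β * v j))))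
    (InKSpan-lincomb (α ∷ β ∷ []) {u ∷ v ∷ []} λ { zero → u∈ ; (suc zero) → v∈ })

  InKSpan-· : ∀ {k} {g : Fin k → V} {u} a → InKSpan g u → InKSpan g (a · u)
  InKSpan-· {u = u} a u∈ = InKSpan-resp (λ j → sym (+-identityʳ (a * u j))) (InKSpan-lincomb (a ∷ []) {u ∷ []} (λ { zero → u∈ }))

  InW-lincomb : ∀ {k} {b : Fin n → V} (f : Fin k → K) {u : Fin k → V} → IsFq f → (∀ i → InW b (u i)) → InW b (lincomb f u)
  InW-lincomb {b = b} f f∈F u∈ = combination f (λ i → proj₁ (u∈ i)) ,
    (λ j → sum-inF _ (λ i → F-* _ _ (f∈F i) (proj₁ (proj₂ (u∈ i)) j))) ,
    (λ x → trans (lincomb-cong f (λ i → proj₂ (proj₂ (u∈ i))) x) (lincomb-lincomb f (λ i → proj₁ (u∈ i)) b x))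

  KIndep⇒FqIndep : ∀ {k} {g : Fin k → V} → KIndep g → FqIndep g
  KIndep⇒FqIndep g-indep c _ = g-indep c

  FqIndep⇒Nonzero : ∀ {k} {g : Fin k → V} → FqIndep g → ∀ i → Nonzero (g i)
  FqIndep⇒Nonzero {g = g} g-indep i gi≋0 =
    1≢0 (trans (sym (unit-diagonal i)) (g-indep (unit i) (unit-IsFq i) (λ j → trans (lincomb-unit i g j) (gi≋0 j)) i))

  FqIndep-in-W⇒KIndep : ∀ {b : Fin n → V} → KIndep b → ∀ {k} (w : Fin k → V) → (∀ i → InW b (w i)) → FqIndep w → KIndep w
  FqIndep-in-W⇒KIndep {b} b-indep {k} w w∈W w-indep a a-rel =
    Fq-rows-independent⇒K-independent C (λ i → proj₁ (proj₂ (w∈W i))) C-indep a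
      (b-indep (combination a C) (λ x → trans (sym (in-coordinates a x)) (a-rel x)))
    where
      C : Rows k n
      C i = proj₁ (w∈W i)
      in-coordinates : ∀ f → lincomb f w ≋ lincomb (combination f C) b
      in-coordinates f x = trans (lincomb-cong f (λ i → proj₂ (proj₂ (w∈W i))) x) (lincomb-lincomb f C b x)
      C-indep : FqIndependentRows C
      C-indep f f∈F f-rel = w-indep f f∈F (λ x → trans (in-coordinates f x) (lincomb-zeros b f-rel x))

  skew-KIndep : ∀ {k m} {g : Fin k → V} {h : Fin m → V} → Skew g h → KIndep g → KIndep h →
                ∀ c d → (lincomb c g ⊕ lincomb d h) ≋ zeroV → (∀ i → c i ≡ 0#) × (∀ i → d i ≡ 0#)
  skew-KIndep {g = g} {h} skew g-indep h-indep c d rel = g-indep c y≋0 , h-indep d dh≋0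
    where
      y≋0 : lincomb c g ≋ zeroV
      y≋0 = skew (lincomb c g) (InKSpan-self c g)
              (InKSpan-resp (λ j → trans (x+y≡0⇒x≡-y (rel j)) (sym (-1*x≈-x _))) (InKSpan-· (- 1#) (InKSpan-self d h)))
      dh≋0 : lincomb d h ≋ zeroV
      dh≋0 j = trans (sym (+-identityˡ _)) (trans (cong (_+ lincomb d h j) (sym (y≋0 j))) (rel j))

  ≋zero? : (v : V) → Dec (v ≋ zeroV)
  ≋zero? v = all? (λ j → v j ≟ 0#)

  a·v≋0⇒a≡0 : ∀ {a v} → Nonzero v → (a · v) ≋ zeroV → a ≡ 0#
  a·v≋0⇒a≡0 {a} {v} v≢0 av≋0 with nonzero-entry v v≢0
  ... | j , vj≢0 = x*y≡0⇒y≡0 vj≢0 (trans (*-comm _ _) (av≋0 j))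

  Proportional-sym : ∀ {u v} → Proportional u v → Proportional v u
  Proportional-sym {u} {v} (a , a≢0 , u≋av) = inv a a≢0 , inv≢0 a a≢0 ,
    (λ j → sym (trans (cong (inv a a≢0 *_) (u≋av j)) (inv-cancelˡ a a≢0 (v j))))

  Proportional-trans : ∀ {u v w} → Proportional u v → Proportional v w → Proportional u w
  Proportional-trans (a , a≢0 , u≋av) (c , c≢0 , v≋cw) = a * c , x*y≢0 a≢0 c≢0 ,
    (λ j → trans (u≋av j) (trans (cong (a *_) (v≋cw j)) (sym (*-assoc _ _ _))))

  non-proportional⇒independent : ∀ {x y} → Nonzero x → Nonzero y → ¬ Proportional x y →
                                 ∀ {α β} → ((α · x) ⊕ (β · y)) ≋ zeroV → (α ≡ 0#) × (β ≡ 0#)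
  non-proportional⇒independent {x} {y} x≢0 y≢0 x≁y {α} {β} rel with α ≟ 0#
  ... | yes α≡0 = α≡0 , a·v≋0⇒a≡0 y≢0 (λ j → trans (sym (+-identityˡ _))
                         (trans (cong (_+ β * y j) (sym (trans (cong (_* x j) α≡0) (zeroˡ (x j))))) (rel j)))
  ... | no α≢0 with (- (inv α α≢0 * β)) ≟ 0#
  ...   | yes s≡0 = ⊥-elim (x≢0 λ j → trans (a*x+b*y≡0⇒x≡-a⁻¹b*y α≢0 (rel j)) (trans (cong (_* y j) s≡0) (zeroˡ _)))
  ...   | no s≢0  = ⊥-elim (x≁y (_ , s≢0 , λ j → a*x+b*y≡0⇒x≡-a⁻¹b*y α≢0 (rel j)))

  pairs-on-distinct-points-FqIndep : ∀ {x x'} → Nonzero x → Nonzero x' → ¬ Proportional x x' →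
    ∀ {g g' : Fin 2 → V} (a a' : Fin 2 → K) → (∀ i → g i ≋ (a i · x)) → (∀ i → g' i ≋ (a' i · x')) →
    FqIndep g → FqIndep g' → FqIndep (g zero ∷ g (suc zero) ∷ g' zero ∷ g' (suc zero) ∷ [])
  pairs-on-distinct-points-FqIndep {x} {x'} x≢0 x'≢0 x≁x' {g} {g'} a a' g≋ax g'≋a'x' g-indep g'-indep f f∈F rel =
    λ { zero → f₀₁≡0 zero ; (suc zero) → f₀₁≡0 (suc zero)
      ; (suc (suc zero)) → f₂₃≡0 zero ; (suc (suc (suc zero))) → f₂₃≡0 (suc zero) }
    where
      f₀₁ f₂₃ : Fin 2 → K
      f₀₁ = f zero ∷ f (suc zero) ∷ []
      f₂₃ = f (suc (suc zero)) ∷ f (suc (suc (suc zero))) ∷ []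
      s s' : K
      s  = sum (λ i → f₀₁ i * a i)
      s' = sum (λ i → f₂₃ i * a' i)
      split : ((s · x) ⊕ (s' · x')) ≋ zeroV
      split j = begin
        s * x j + s' * x' j                 ≡⟨ cong₂ _+_ (lincomb-on-point f₀₁ a g≋ax j) (lincomb-on-point f₂₃ a' g'≋a'x' j) ⟨
        lincomb f₀₁ g j + lincomb f₂₃ g' j  ≡⟨ cong₂ _+_ (lincomb₂ f₀₁ g j) (lincomb₂ f₂₃ g' j) ⟩
        (A + B) + (C + D)                   ≡⟨ solve 4 (λ A B C D → (A :+ B) :+ (C :+ D) := A :+ (B :+ (C :+ D))) refl A B C D ⟩
        A + (B + (C + D))                   ≡⟨ cong (λ z → A + (B + (C + z))) (+-identityʳ D) ⟨
        A + (B + (C + (D + 0#)))            ≡⟨ rel j ⟩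
        0#                                  ∎
        where
          open ≡-Reasoning
          A B C D : K
          A = f zero * g zero j
          B = f (suc zero) * g (suc zero) j
          C = f (suc (suc zero)) * g' zero j
          D = f (suc (suc (suc zero))) * g' (suc zero) j
      scalars≡0 : (s ≡ 0#) × (s' ≡ 0#)
      scalars≡0 = non-proportional⇒independent x≢0 x'≢0 x≁x' split
      f₀₁≡0 : ∀ i → f₀₁ i ≡ 0#
      f₀₁≡0 = g-indep f₀₁ (λ { zero → f∈F zero ; (suc zero) → f∈F (suc zero) })
                (λ j → trans (lincomb-on-point f₀₁ a g≋ax j) (trans (cong (_* x j) (proj₁ scalars≡0)) (zeroˡ _)))
      f₂₃≡0 : ∀ i → f₂₃ i ≡ 0#
      f₂₃≡0 = g'-indep f₂₃ (λ { zero → f∈F (suc (suc zero)) ; (suc zero) → f∈F (suc (suc (suc zero))) })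
                (λ j → trans (lincomb-on-point f₂₃ a' g'≋a'x' j) (trans (cong (_* x' j) (proj₂ scalars≡0)) (zeroˡ _)))

  -- δ₁ v − γ₁ v' = (γ₀ δ₁ − γ₁ δ₀) w₀ lies in the span of p, which does not contain w₀
  line-meets-span-in-one-point : ∀ {k} {p : Fin k → V} {w : Fin 2 → V} {v v'} → ¬ InKSpan p (w zero) →
    (γ : Fin 2 → K) → γ (suc zero) ≢0 → v ≋ lincomb γ w → InKSpan w v' →
    InKSpan p v → InKSpan p v' → Nonzero v' → Proportional v v'
  line-meets-span-in-one-point {p = p} {w} {v} {v'} w₀∉p γ γ₁≢0 v≋γw (δ , v'≋δw) v∈p v'∈p v'≢0 = by-cases (D ≟ 0#)
    where
      D : K
      D = γ zero * δ (suc zero) + - (γ (suc zero) * δ zero)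
      combination≋Dw₀ : ((δ (suc zero) · v) ⊕ ((- γ (suc zero)) · v')) ≋ (D · w zero)
      combination≋Dw₀ j = begin
        δ₁ * v j + (- γ₁) * v' j                              ≡⟨ cong₂ (λ y z → δ₁ * y + (- γ₁) * z) v≋ v'≋ ⟩
        δ₁ * (γ₀ * w₀ + γ₁ * w₁) + (- γ₁) * (δ₀ * w₀ + δ₁ * w₁)
          ≡⟨ solve 6 (λ γ₀ γ₁ δ₀ δ₁ w₀ w₁ →
                        δ₁ :* (γ₀ :* w₀ :+ γ₁ :* w₁) :+ (:- γ₁) :* (δ₀ :* w₀ :+ δ₁ :* w₁) := (γ₀ :* δ₁ :- γ₁ :* δ₀) :* w₀)
                     refl γ₀ γ₁ δ₀ δ₁ w₀ w₁ ⟩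
        D * w₀                                                ∎
        where
          open ≡-Reasoning
          γ₀ γ₁ δ₀ δ₁ w₀ w₁ : K
          γ₀ = γ zero
          γ₁ = γ (suc zero)
          δ₀ = δ zero
          δ₁ = δ (suc zero)
          w₀ = w zero j
          w₁ = w (suc zero) j
          v≋ : v j ≡ γ₀ * w₀ + γ₁ * w₁
          v≋ = trans (v≋γw j) (lincomb₂ γ w j)
          v'≋ : v' j ≡ δ₀ * w₀ + δ₁ * w₁
          v'≋ = trans (v'≋δw j) (lincomb₂ δ w j)
      by-cases : Dec (D ≡ 0#) → Proportional v v'
      by-cases (no D≢0) = ⊥-elim (w₀∉p (InKSpan-resp {g = p} w₀≋ (InKSpan-· {g = p} (inv D D≢0)
                                   (InKSpan-+ {g = p} (δ (suc zero)) (- γ (suc zero)) v∈p v'∈p))))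
        where
          w₀≋ : w zero ≋ (inv D D≢0 · ((δ (suc zero) · v) ⊕ ((- γ (suc zero)) · v')))
          w₀≋ j = trans (sym (inv-cancelˡ D D≢0 (w zero j))) (cong (inv D D≢0 *_) (sym (combination≋Dw₀ j)))
      by-cases (yes D≡0) =
        _ , -‿≢0 (x*y≢0 (inv≢0 _ δ₁≢0) (-‿≢0 γ₁≢0)) , (λ j → a*x+b*y≡0⇒x≡-a⁻¹b*y δ₁≢0 (combination≋0 j))
        where
          combination≋0 : ((δ (suc zero) · v) ⊕ ((- γ (suc zero)) · v')) ≋ zeroV
          combination≋0 j = trans (combination≋Dw₀ j) (trans (cong (_* w zero j) D≡0) (zeroˡ _))
          δ₁≢0 : δ (suc zero) ≢0
          δ₁≢0 δ₁≡0 = -‿≢0 γ₁≢0 (a·v≋0⇒a≡0 v'≢0 (λ j → trans (sym (+-identityˡ _))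
                        (trans (cong (_+ (- γ (suc zero)) * v' j) (sym (trans (cong (_* v j) δ₁≡0) (zeroˡ _))))
                               (combination≋0 j))))

  rank≤1 : ∀ {b : Fin n → V} {v w} a → InW b w → v ≋ (a · w) → RankLE b 1 v
  rank≤1 {w = w} a w∈W v≋aw = (λ _ → w) , (λ _ → w∈W) , (λ _ → a) , (λ j → trans (v≋aw j) (sym (+-identityʳ _)))

  Nonzero⇒rank≢0 : ∀ {b : Fin n → V} {v} → Nonzero v → ¬ RankLE b 0 v
  Nonzero⇒rank≢0 v≢0 (_ , _ , _ , v≋0) = v≢0 v≋0

  HasCount-≤ : ∀ {P Q : V → Set} {k₁ k₂} → HasCount P k₁ → HasCount Q k₂ →
               (φ : ∀ v → P v → V) → (∀ v pv → Q (φ v pv)) →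
               (∀ u v pu pv → ¬ Proportional u v → ¬ Proportional (φ u pu) (φ v pv)) → k₁ ≤ k₂
  HasCount-≤ {k₁ = k₁} {k₂} (f₁ , f₁∈P , distinct₁ , _) (f₂ , _ , _ , cover₂) φ φ∈Q φ-distinct = injective⇒≤ injective
    where
      φ₁ : Fin k₁ → V
      φ₁ i = φ (f₁ i) (f₁∈P i)
      index : Fin k₁ → Fin k₂
      index i = proj₁ (cover₂ (φ₁ i) (φ∈Q _ _))
      φ₁∝f₂ : ∀ i → Proportional (φ₁ i) (f₂ (index i))
      φ₁∝f₂ i = proj₂ (cover₂ (φ₁ i) (φ∈Q _ _))
      injective : ∀ {i j} → index i ≡ index j → i ≡ j
      injective {i} {j} same with i Fin.≟ j
      ... | yes i≡j = i≡j
      ... | no i≢j = ⊥-elim (φ-distinct _ _ _ _ (λ f₁i∝f₁j → i≢j (distinct₁ i j f₁i∝f₁j))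
                        (Proportional-trans (φ₁∝f₂ i) (subst (λ k → Proportional (f₂ k) (φ₁ j)) (sym same) f₂∝φ₁j)))
        where
          f₂∝φ₁j : Proportional (f₂ (index j)) (φ₁ j)
          f₂∝φ₁j = Proportional-sym (φ₁∝f₂ j)

module Configuration {q n : ℕ} (𝔽 : FqnField q n)
  (b : Fin n → Geom.V 𝔽) (b-indep : Geom.KIndep 𝔽 b)
  {m : ℕ} (p : Fin m → Geom.V 𝔽) (p-indep : Geom.KIndep 𝔽 p) (Ω∩Π≡∅ : Geom.SkewΩ 𝔽 b p)
  (l : Fin 2 → Geom.V 𝔽) (l-indep : Geom.KIndep 𝔽 l) (Π∩ℓ≡0 : Geom.Skew 𝔽 p l)
  (ℓ+Π≡V : n ≤ 2 ℕ.+ m) where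
  open FqnField 𝔽
  open Geom 𝔽
  open FieldFacts 𝔽
  open GaussianElimination 𝔽
  open Vectors 𝔽

  W∩Π≋0 : ∀ {w} → InW b w → InKSpan p w → w ≋ zeroV
  W∩Π≋0 {w} w∈W w∈Π with ≋zero? w
  ... | yes w≋0 = w≋0
  ... | no w≢0  = ⊥-elim (Ω∩Π≡∅ w w∈W w≢0 w∈Π)

  -- the 3 + m > n vectors w, l₀, l₁, p₀, … are dependent, and the coefficient of w cannot vanish
  projection-exists : ∀ w → ∃ (ProjOf p l w)
  projection-exists w = (s · yℓ) , InKSpan-· {g = l} s (InKSpan-self cℓ l) ,
      InKSpan-resp {g = p} w-u≋ (InKSpan-· {g = p} s (InKSpan-self cΠ p))
    where
      h : Fin (3 ℕ.+ m) → V
      h = w ∷ l zero ∷ l (suc zero) ∷ p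
      dependency : ∃ λ a → (∃ λ k → a k ≢0) × IsRelation h a
      dependency = more-rows-than-columns⇒dependent (s≤s ℓ+Π≡V) h
      a : Fin (3 ℕ.+ m) → K
      a = proj₁ dependency
      cℓ : Fin 2 → K
      cℓ = a (suc zero) ∷ a (suc (suc zero)) ∷ []
      cΠ : Fin m → K
      cΠ i = a (suc (suc (suc i)))
      yℓ yΠ : V
      yℓ = lincomb cℓ l
      yΠ = lincomb cΠ p
      relation : ∀ j → a zero * w j + (yℓ j + yΠ j) ≡ 0#
      relation j = begin
        a zero * w j + (yℓ j + yΠ j)                  ≡⟨ cong (λ t → a zero * w j + ((a₁l₀ + t) + yΠ j)) (+-identityʳ a₂l₁) ⟩
        a zero * w j + ((a₁l₀ + a₂l₁) + yΠ j)         ≡⟨ cong (a zero * w j +_) (+-assoc a₁l₀ a₂l₁ (yΠ j)) ⟩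
        lincomb a h j                                 ≡⟨ lincomb-coordinate a h j ⟩
        combination a h j                             ≡⟨ proj₂ (proj₂ dependency) j ⟩
        0#                                            ∎
        where
          open ≡-Reasoning
          a₁l₀ a₂l₁ : K
          a₁l₀ = a (suc zero) * l zero j
          a₂l₁ = a (suc (suc zero)) * l (suc zero) j
      a₀≢0 : a zero ≢0
      a₀≢0 a₀≡0 = nontrivial (proj₁ (proj₂ dependency))
        where
          zeros : (∀ i → cΠ i ≡ 0#) × (∀ i → cℓ i ≡ 0#)
          zeros = skew-KIndep {g = p} {h = l} Π∩ℓ≡0 p-indep l-indep cΠ cℓ λ j →
            trans (+-comm _ _) (trans (sym (+-identityˡ _))
                  (trans (cong (_+ (yℓ j + yΠ j)) (sym (trans (cong (_* w j) a₀≡0) (zeroˡ _)))) (relation j)))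
          nontrivial : ¬ (∃ λ k → a k ≢0)
          nontrivial (zero , a≢0)              = a≢0 a₀≡0
          nontrivial (suc zero , a≢0)          = a≢0 (proj₂ zeros zero)
          nontrivial (suc (suc zero) , a≢0)    = a≢0 (proj₂ zeros (suc zero))
          nontrivial (suc (suc (suc i)) , a≢0) = a≢0 (proj₁ zeros i)
      s : K
      s = - inv (a zero) a₀≢0
      w-u≋ : (w ⊖ (s · yℓ)) ≋ (s · yΠ)
      w-u≋ j = trans (cong₂ _+_ (a*x+y≡0⇒x≡-a⁻¹*y a₀≢0 (relation j)) (-1*x≈-x _))
                     (solve 3 (λ s x y → s :* (x :+ y) :+ :- (s :* x) := s :* y) refl s (yℓ j) (yΠ j))

  Preimages : ∀ {k} → (Fin k → V) → (Fin k → V) → Set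
  Preimages w u = ∀ i → InW b (w i) × ProjOf p l (w i) (u i)

  module _ {k} {w u : Fin k → V} (preimages : Preimages w u) (f : Fin k → K) where

    private
      difference : V
      difference = lincomb f (λ i → w i ⊖ u i)

      difference∈Π : InKSpan p difference
      difference∈Π = InKSpan-lincomb {g = p} f (λ i → proj₂ (proj₂ (preimages i)))

      lincomb-split : lincomb f w ≋ (lincomb f u ⊕ difference)
      lincomb-split j = trans (lincomb-cong f w≋u⊕w⊖u j) (lincomb-⊕ f u (λ i → w i ⊖ u i) j)
        where
          w≋u⊕w⊖u : ∀ i → w i ≋ (u i ⊕ (w i ⊖ u i))
          w≋u⊕w⊖u i j = trans (solve 2 (λ x y → x := y :+ (x :+ :- y)) refl (w i j) (u i j))
                              (cong (λ z → u i j + (w i j + z)) (sym (-1*x≈-x (u i j))))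

    image≋0⇒preimage∈Π : lincomb f u ≋ zeroV → InKSpan p (lincomb f w)
    image≋0⇒preimage∈Π fu≋0 = InKSpan-resp {g = p} fw≋difference difference∈Π
      where
        fw≋difference : lincomb f w ≋ difference
        fw≋difference j = trans (lincomb-split j) (trans (cong (_+ difference j) (fu≋0 j)) (+-identityˡ _))

    preimage∈Π⇒image≋0 : InKSpan p (lincomb f w) → lincomb f u ≋ zeroV
    preimage∈Π⇒image≋0 fw∈Π = Π∩ℓ≡0 (lincomb f u)
      (InKSpan-resp {g = p} fu≋fw-d (InKSpan-+ {g = p} 1# (- 1#) fw∈Π difference∈Π))
      (InKSpan-lincomb {g = l} f (λ i → proj₁ (proj₂ (preimages i))))
      where
        fu≋fw-d : lincomb f u ≋ ((1# · lincomb f w) ⊕ ((- 1#) · difference))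
        fu≋fw-d j = begin
          lincomb f u j
            ≡⟨ solve 2 (λ x d → x := (x :+ d) :+ :- d) refl (lincomb f u j) (difference j) ⟩
          (lincomb f u j + difference j) + - difference j
            ≡⟨ cong₂ _+_ (sym (trans (*-identityˡ _) (lincomb-split j))) (sym (-1*x≈-x _)) ⟩
          1# * lincomb f w j + (- 1#) * difference j
            ∎
          where open ≡-Reasoning

  preimage-relation : ∀ {k} {w u : Fin k → V} → Preimages w u →
                      ∀ f → IsFq f → lincomb f u ≋ zeroV → lincomb f w ≋ zeroV
  preimage-relation preimages f f∈F fu≋0 =
    W∩Π≋0 (InW-lincomb f f∈F (λ i → proj₁ (preimages i))) (image≋0⇒preimage∈Π preimages f fu≋0)

  preimages-FqIndep : ∀ {k} {w u : Fin k → V} → Preimages w u → FqIndep u → FqIndep w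
  preimages-FqIndep preimages u-indep f f∈F fw≋0 =
    u-indep f f∈F (preimage∈Π⇒image≋0 preimages f (InKSpan-resp {g = p} fw≋0 (InKSpan-zero p)))

  images-FqIndep : ∀ {k} {w u : Fin k → V} → Preimages w u → FqIndep w → FqIndep u
  images-FqIndep preimages w-indep f f∈F fu≋0 = w-indep f f∈F (preimage-relation preimages f f∈F fu≋0)

  Π-rank≢1 : ∀ {v} → InKSpan p v → Nonzero v → ¬ RankLE b 1 v
  Π-rank≢1 {v} v∈Π v≢0 (w , w∈W , c , v≋cw) = v≢0 (λ j → trans (v≋c₀w₀ j) (trans (cong (c zero *_) (w₀≋0 j)) (zeroʳ _)))
    where
      v≋c₀w₀ : v ≋ (c zero · w zero)
      v≋c₀w₀ j = trans (v≋cw j) (+-identityʳ _)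
      c₀≢0 : c zero ≢0
      c₀≢0 c₀≡0 = v≢0 (λ j → trans (v≋c₀w₀ j) (trans (cong (_* w zero j) c₀≡0) (zeroˡ _)))
      w₀≋c₀⁻¹v : w zero ≋ (inv (c zero) c₀≢0 · v)
      w₀≋c₀⁻¹v j = trans (sym (inv-cancelˡ _ c₀≢0 (w zero j))) (cong (inv (c zero) c₀≢0 *_) (sym (v≋c₀w₀ j)))
      w₀≋0 : w zero ≋ zeroV
      w₀≋0 = W∩Π≋0 (w∈W zero) (InKSpan-resp {g = p} w₀≋c₀⁻¹v (InKSpan-· {g = p} (inv (c zero) c₀≢0) v∈Π))

  rank2-KIndep : ∀ {v} {w : Fin 2 → V} → (∀ i → InW b (w i)) → InKSpan w v → ¬ RankLE b 1 v → KIndep w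
  rank2-KIndep {v} {w} w∈W (c , v≋cw) rank≢1 d d-rel = λ { zero → d₀≡0 ; (suc zero) → d₁≡0 }
    where
      w₀ w₁ : V
      w₀ = w zero
      w₁ = w (suc zero)
      relation : ∀ j → d zero * w₀ j + d (suc zero) * w₁ j ≡ 0#
      relation j = trans (sym (lincomb₂ d w j)) (d-rel j)
      v≋ : ∀ j → v j ≡ c zero * w₀ j + c (suc zero) * w₁ j
      v≋ j = trans (v≋cw j) (lincomb₂ c w j)
      d₀≡0 : d zero ≡ 0#
      d₀≡0 with d zero ≟ 0#
      ... | yes d₀≡0 = d₀≡0
      ... | no d₀≢0  = ⊥-elim (rank≢1 (rank≤1 (c zero * t + c (suc zero)) (w∈W (suc zero)) v≋tw₁))
        where
          t : K
          t = - (inv (d zero) d₀≢0 * d (suc zero))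
          v≋tw₁ : v ≋ ((c zero * t + c (suc zero)) · w₁)
          v≋tw₁ j = begin
            v j                                      ≡⟨ v≋ j ⟩
            c zero * w₀ j + c (suc zero) * w₁ j
              ≡⟨ cong (λ z → c zero * z + c (suc zero) * w₁ j) (a*x+b*y≡0⇒x≡-a⁻¹b*y d₀≢0 (relation j)) ⟩
            c zero * (t * w₁ j) + c (suc zero) * w₁ j
              ≡⟨ solve 4 (λ c₀ c₁ t w → c₀ :* (t :* w) :+ c₁ :* w := (c₀ :* t :+ c₁) :* w) refl
                         (c zero) (c (suc zero)) t (w₁ j) ⟩
            (c zero * t + c (suc zero)) * w₁ j       ∎
            where open ≡-Reasoning
      d₁≡0 : d (suc zero) ≡ 0#
      d₁≡0 with d (suc zero) ≟ 0#
      ... | yes d₁≡0 = d₁≡0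
      ... | no d₁≢0  = ⊥-elim (rank≢1 (rank≤1 (c zero) (w∈W zero) v≋c₀w₀))
        where
          w₁≋0 : w₁ ≋ zeroV
          w₁≋0 j = x*y≡0⇒y≡0 d₁≢0 (trans (sym (+-identityˡ _))
                     (trans (cong (_+ d (suc zero) * w₁ j) (sym (trans (cong (_* w₀ j) d₀≡0) (zeroˡ _)))) (relation j)))
          v≋c₀w₀ : v ≋ (c zero · w₀)
          v≋c₀w₀ j = trans (v≋ j) (trans (cong (λ z → c zero * w₀ j + c (suc zero) * z) (w₁≋0 j))
                                         (trans (cong (c zero * w₀ j +_) (zeroʳ _)) (+-identityʳ _)))

  module FromWeight2Point {x} (x-weight2 : Weight2Point b p l x) where

    x≢0 : Nonzero x
    x≢0 = proj₁ (proj₂ x-weight2)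

    g : Fin 2 → V
    g = proj₁ (proj₁ (proj₂ (proj₂ x-weight2)))

    g-on-x : ∀ i → UonPoint b p l x (g i)
    g-on-x = proj₁ (proj₂ (proj₁ (proj₂ (proj₂ x-weight2))))

    g-indep : FqIndep g
    g-indep = proj₂ (proj₂ (proj₁ (proj₂ (proj₂ x-weight2))))

    a : Fin 2 → K
    a i = proj₁ (proj₂ (g-on-x i))

    g≋ax : ∀ i → g i ≋ (a i · x)
    g≋ax i = proj₂ (proj₂ (g-on-x i))

    a≢0 : ∀ i → a i ≢0
    a≢0 i a≡0 = FqIndep⇒Nonzero {g = g} g-indep i
                  (λ j → trans (g≋ax i j) (trans (cong (_* x j) a≡0) (zeroˡ _)))

    w : Fin 2 → V
    w i = proj₁ (proj₁ (g-on-x i))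

    preimages : Preimages w g
    preimages i = proj₂ (proj₁ (g-on-x i))

    w-indep : KIndep w
    w-indep = FqIndep-in-W⇒KIndep b-indep w (λ i → proj₁ (preimages i))
                (preimages-FqIndep {w = w} {u = g} preimages g-indep)

    coefficients : Fin 2 → K
    coefficients = a (suc zero) ∷ (- a zero) ∷ []

    -- a₁ g₀ − a₀ g₁ = 0, so the same combination of the preimages lies in Π
    v : V
    v = lincomb coefficients w

    v∈Π : InKSpan p v
    v∈Π = image≋0⇒preimage∈Π {w = w} {u = g} preimages coefficients λ j →
      trans (lincomb₂ coefficients g j)
            (trans (cong₂ (λ y z → a (suc zero) * y + (- a zero) * z) (g≋ax zero j) (g≋ax (suc zero) j))
                   (trans (solve 3 (λ a₀ a₁ x → a₁ :* (a₀ :* x) :+ (:- a₀) :* (a₁ :* x) := a₀ :- a₀) refl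
                                   (a zero) (a (suc zero)) (x j))
                          (-‿inverseʳ (a zero))))

    v≢0 : Nonzero v
    v≢0 v≋0 = a≢0 (suc zero) (w-indep coefficients v≋0 zero)

    v-rank2 : Rank2PointOfΠ b p v
    v-rank2 = v∈Π , v≢0 , (w , (λ i → proj₁ (preimages i)) , InKSpan-self coefficients w) ,
              Π-rank≢1 v∈Π v≢0 , Nonzero⇒rank≢0 v≢0

  -- the four preimages are K-independent, so the lines ⟨w₀, w₁⟩ and ⟨w₀', w₁'⟩ they span are disjoint
  weight2→rank2-distinct : ∀ {x x'} (x-weight2 : Weight2Point b p l x) (x'-weight2 : Weight2Point b p l x') →
    ¬ Proportional x x' → ¬ Proportional (FromWeight2Point.v x-weight2) (FromWeight2Point.v x'-weight2)
  weight2→rank2-distinct x-weight2 x'-weight2 x≁x' (c , _ , v≋cv') = A.a≢0 (suc zero) (W₄-indep coefficients₄ relation zero)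
    where
      module A = FromWeight2Point x-weight2
      module B = FromWeight2Point x'-weight2
      W₄ U₄ : Fin 4 → V
      W₄ = A.w zero ∷ A.w (suc zero) ∷ B.w zero ∷ B.w (suc zero) ∷ []
      U₄ = A.g zero ∷ A.g (suc zero) ∷ B.g zero ∷ B.g (suc zero) ∷ []
      preimages₄ : Preimages W₄ U₄
      preimages₄ zero                   = A.preimages zero
      preimages₄ (suc zero)             = A.preimages (suc zero)
      preimages₄ (suc (suc zero))       = B.preimages zero
      preimages₄ (suc (suc (suc zero))) = B.preimages (suc zero)
      W₄-indep : KIndep W₄
      W₄-indep = FqIndep-in-W⇒KIndep b-indep W₄ (λ i → proj₁ (preimages₄ i))
        (preimages-FqIndep {w = W₄} {u = U₄} preimages₄
          (pairs-on-distinct-points-FqIndep A.x≢0 B.x≢0 x≁x' {A.g} {B.g} A.a B.a A.g≋ax B.g≋ax A.g-indep B.g-indep))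
      coefficients₄ : Fin 4 → K
      coefficients₄ = A.a (suc zero) ∷ (- A.a zero) ∷ (- (c * B.a (suc zero))) ∷ (c * B.a zero) ∷ []
      relation : lincomb coefficients₄ W₄ ≋ zeroV
      relation j = begin
        lincomb coefficients₄ W₄ j
          ≡⟨ cong (λ z → a₁ * w₀ + ((- a₀) * w₁ + ((- (c * b₁)) * w₀' + z))) (+-identityʳ _) ⟩
        a₁ * w₀ + ((- a₀) * w₁ + ((- (c * b₁)) * w₀' + (c * b₀) * w₁'))
          ≡⟨ solve 9 (λ a₁ a₀ b₁ b₀ c w₀ w₁ w₀' w₁' →
                 a₁ :* w₀ :+ ((:- a₀) :* w₁ :+ ((:- (c :* b₁)) :* w₀' :+ (c :* b₀) :* w₁'))
                 := (a₁ :* w₀ :+ (:- a₀) :* w₁) :- c :* (b₁ :* w₀' :+ (:- b₀) :* w₁'))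
               refl a₁ a₀ b₁ b₀ c w₀ w₁ w₀' w₁' ⟩
        (a₁ * w₀ + (- a₀) * w₁) + - (c * (b₁ * w₀' + (- b₀) * w₁'))
          ≡⟨ cong₂ (λ y z → y + - (c * z)) (lincomb₂ A.coefficients A.w j) (lincomb₂ B.coefficients B.w j) ⟨
        A.v j + - (c * B.v j)
          ≡⟨ trans (cong (_+ - (c * B.v j)) (v≋cv' j)) (-‿inverseʳ _) ⟩
        0# ∎
        where
          open ≡-Reasoning
          a₀ a₁ b₀ b₁ w₀ w₁ w₀' w₁' : K
          a₀ = A.a zero
          a₁ = A.a (suc zero)
          b₀ = B.a zero
          b₁ = B.a (suc zero)
          w₀ = A.w zero j
          w₁ = A.w (suc zero) j
          w₀' = B.w zero j
          w₁' = B.w (suc zero) j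

  module FromRank2Point (only-weights-1-2 : OnlyWeights12 b p l) {v} (v-rank2 : Rank2PointOfΠ b p v) where

    v∈Π : InKSpan p v
    v∈Π = proj₁ v-rank2

    v≢0 : Nonzero v
    v≢0 = proj₁ (proj₂ v-rank2)

    rank≢1 : ¬ RankLE b 1 v
    rank≢1 = proj₁ (proj₂ (proj₂ (proj₂ v-rank2)))

    w : Fin 2 → V
    w = proj₁ (proj₁ (proj₂ (proj₂ v-rank2)))

    w∈W : ∀ i → InW b (w i)
    w∈W = proj₁ (proj₂ (proj₁ (proj₂ (proj₂ v-rank2))))

    γ : Fin 2 → K
    γ = proj₁ (proj₂ (proj₂ (proj₁ (proj₂ (proj₂ v-rank2)))))

    v≋γw : v ≋ lincomb γ w
    v≋γw = proj₂ (proj₂ (proj₂ (proj₁ (proj₂ (proj₂ v-rank2)))))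

    w-indep : KIndep w
    w-indep = rank2-KIndep w∈W (γ , v≋γw) rank≢1

    γ₁≢0 : γ (suc zero) ≢0
    γ₁≢0 γ₁≡0 = rank≢1 (rank≤1 (γ zero) (w∈W zero) v≋γ₀w₀)
      where
        v≋γ₀w₀ : v ≋ (γ zero · w zero)
        v≋γ₀w₀ j = trans (v≋γw j) (trans (lincomb₂ γ w j)
                     (trans (cong (λ z → γ zero * w zero j + z * w (suc zero) j) γ₁≡0)
                            (trans (cong (γ zero * w zero j +_) (zeroˡ _)) (+-identityʳ _))))

    w₀∉Π : ¬ InKSpan p (w zero)
    w₀∉Π w₀∈Π = FqIndep⇒Nonzero {g = w} (KIndep⇒FqIndep {g = w} w-indep) zero (W∩Π≋0 (w∈W zero) w₀∈Π)

    u : Fin 2 → V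
    u i = proj₁ (projection-exists (w i))

    preimages : Preimages w u
    preimages i = w∈W i , proj₂ (projection-exists (w i))

    u-indep : FqIndep u
    u-indep = images-FqIndep {w = w} {u = u} preimages (KIndep⇒FqIndep {g = w} w-indep)

    x : V
    x = u zero

    x≢0 : Nonzero x
    x≢0 = FqIndep⇒Nonzero {g = u} u-indep zero

    s : K
    s = - (inv (γ (suc zero)) γ₁≢0 * γ zero)

    u₁≋sx : u (suc zero) ≋ (s · x)
    u₁≋sx j = a*x+b*y≡0⇒x≡-a⁻¹b*y γ₁≢0 (trans (+-comm _ _) (trans (sym (lincomb₂ γ u j)) (γu≋0 j)))
      where
        γu≋0 : lincomb γ u ≋ zeroV
        γu≋0 = preimage∈Π⇒image≋0 {w = w} {u = u} preimages γ (InKSpan-resp {g = p} (λ j → sym (v≋γw j)) v∈Π)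

    u-on-x : ∀ i → UonPoint b p l x (u i)
    u-on-x zero       = (w zero , preimages zero) , 1# , (λ j → sym (*-identityˡ _))
    u-on-x (suc zero) = (w (suc zero) , preimages (suc zero)) , s , u₁≋sx

    x∈ℓ : InKSpan l x
    x∈ℓ = proj₁ (proj₂ (preimages zero))

    x-weight2 : Weight2Point b p l x
    x-weight2 = x∈ℓ , x≢0 , [ (λ weight1 → ⊥-elim (proj₂ weight1 u u-on-x u-indep)) , id ]′
                              (only-weights-1-2 x (x∈ℓ , x≢0 , x , u-on-x zero , x≢0))

    -- u₀, u₁, u' cannot be F_q-independent since x has weight 2, and a dependency with
    -- nonzero coefficient at u' lifts to one that puts w' in ⟨w₀, w₁⟩
    preimage-of-point-on-x : ∀ {u' w'} → InW b w' → ProjOf p l w' u' → ∀ s' → u' ≋ (s' · x) → ¬ ¬ InKSpan w w'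
    preimage-of-point-on-x {u'} {w'} w'∈W w'↦u' s' u'≋s'x w'∉⟨w⟩ = proj₂ (proj₂ (proj₂ x-weight2)) U₃ U₃-on-x U₃-indep
      where
        W₃ U₃ : Fin 3 → V
        W₃ = w zero ∷ w (suc zero) ∷ w' ∷ []
        U₃ = u zero ∷ u (suc zero) ∷ u' ∷ []
        preimages₃ : Preimages W₃ U₃
        preimages₃ zero             = preimages zero
        preimages₃ (suc zero)       = preimages (suc zero)
        preimages₃ (suc (suc zero)) = w'∈W , w'↦u'
        U₃-on-x : ∀ i → UonPoint b p l x (U₃ i)
        U₃-on-x zero             = u-on-x zero
        U₃-on-x (suc zero)       = u-on-x (suc zero)
        U₃-on-x (suc (suc zero)) = (w' , w'∈W , w'↦u') , s' , u'≋s'x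
        U₃-indep : FqIndep U₃
        U₃-indep f f∈F rel = λ { zero → f₀₁≡0 zero ; (suc zero) → f₀₁≡0 (suc zero) ; (suc (suc zero)) → f₂≡0 }
          where
            f₀₁ : Fin 2 → K
            f₀₁ = f zero ∷ f (suc zero) ∷ []
            W-relation : ∀ j → f (suc (suc zero)) * w' j + lincomb f₀₁ w j ≡ 0#
            W-relation j = trans (solve 4 (λ a b c z → c :+ (a :+ (b :+ z)) := a :+ (b :+ (c :+ z))) refl
                                          (f zero * w zero j) (f (suc zero) * w (suc zero) j) (f (suc (suc zero)) * w' j) 0#)
                                 (preimage-relation {w = W₃} {u = U₃} preimages₃ f f∈F rel j)
            f₂≡0 : f (suc (suc zero)) ≡ 0#
            f₂≡0 with f (suc (suc zero)) ≟ 0#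
            ... | yes f₂≡0 = f₂≡0
            ... | no f₂≢0  = ⊥-elim (w'∉⟨w⟩ (InKSpan-resp {g = w} (λ j → a*x+y≡0⇒x≡-a⁻¹*y f₂≢0 (W-relation j))
                                                          (InKSpan-· {g = w} _ (InKSpan-self f₀₁ w))))
            f₀₁≡0 : ∀ i → f₀₁ i ≡ 0#
            f₀₁≡0 = u-indep f₀₁ (λ { zero → f∈F zero ; (suc zero) → f∈F (suc zero) }) λ j →
              trans (cong (λ z → f zero * u zero j + (f (suc zero) * u (suc zero) j + z))
                          (sym (trans (cong (λ c → c * u' j + 0#) f₂≡0) (trans (+-identityʳ _) (zeroˡ _)))))
                    (rel j)

  -- x ∝ x' puts the preimages w₀', w₁' of v' in the line ⟨w₀, w₁⟩, which meets Π only in ⟨v⟩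
  rank2→weight2-distinct : (only-weights-1-2 : OnlyWeights12 b p l) →
    ∀ {v v'} (v-rank2 : Rank2PointOfΠ b p v) (v'-rank2 : Rank2PointOfΠ b p v') →
    ¬ Proportional v v' →
    ¬ Proportional (FromRank2Point.x only-weights-1-2 v-rank2) (FromRank2Point.x only-weights-1-2 v'-rank2)
  rank2→weight2-distinct only-weights-1-2 v-rank2 v'-rank2 v≁v' x∝x' =
    A.preimage-of-point-on-x (B.w∈W zero) (proj₂ (B.preimages zero)) κ x'≋κx λ w'₀∈⟨w⟩ →
    A.preimage-of-point-on-x (B.w∈W (suc zero)) (proj₂ (B.preimages (suc zero))) (B.s * κ) u'₁≋ λ w'₁∈⟨w⟩ →
    v≁v' (line-meets-span-in-one-point {p = p} {w = A.w} A.w₀∉Π A.γ A.γ₁≢0 A.v≋γw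
           (InKSpan-resp {g = A.w} B.v≋γw
             (InKSpan-lincomb {g = A.w} B.γ {B.w} λ { zero → w'₀∈⟨w⟩ ; (suc zero) → w'₁∈⟨w⟩ }))
           A.v∈Π B.v∈Π B.v≢0)
    where
      module A = FromRank2Point only-weights-1-2 v-rank2
      module B = FromRank2Point only-weights-1-2 v'-rank2
      x'∝x : Proportional B.x A.x
      x'∝x = Proportional-sym {A.x} {B.x} x∝x'
      κ : K
      κ = proj₁ x'∝x
      x'≋κx : B.x ≋ (κ · A.x)
      x'≋κx = proj₂ (proj₂ x'∝x)
      u'₁≋ : B.u (suc zero) ≋ ((B.s * κ) · A.x)
      u'₁≋ j = trans (B.u₁≋sx j) (trans (cong (B.s *_) (x'≋κx j)) (sym (*-assoc _ _ _)))

mainTheorem14 : ∀ {q n : ℕ} → 3 ≤ n → (𝔽 : FqnField q n)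
  → (b : Fin n → Geom.V 𝔽) → Geom.KIndep 𝔽 b
  → (p : Fin (n ∸ 2) → Geom.V 𝔽) → Geom.KIndep 𝔽 p → Geom.SkewΩ 𝔽 b p
  → (l : Fin 2 → Geom.V 𝔽) → Geom.KIndep 𝔽 l → Geom.Skew 𝔽 p l
  → Geom.ProperL 𝔽 b p l
  → Geom.OnlyWeights12 𝔽 b p l
  → ∀ (k₁ k₂ : ℕ)
  → Geom.HasCount 𝔽 (Geom.Weight2Point 𝔽 b p l) k₁
  → Geom.HasCount 𝔽 (Geom.Rank2PointOfΠ 𝔽 b p) k₂
  → k₁ ≡ k₂
mainTheorem14 {n = n} _ 𝔽 b b-indep p p-indep Ω∩Π≡∅ l l-indep Π∩ℓ≡0 _ only-weights-1-2 k₁ k₂ count₁ count₂ =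
  ≤-antisym
    (HasCount-≤ count₁ count₂ (λ _ → FromWeight2Point.v) (λ _ → FromWeight2Point.v-rank2)
                (λ _ _ → weight2→rank2-distinct))
    (HasCount-≤ count₂ count₁ (λ _ → FromRank2Point.x only-weights-1-2)
                (λ _ → FromRank2Point.x-weight2 only-weights-1-2) (λ _ _ → rank2→weight2-distinct only-weights-1-2))
  where
    open Vectors 𝔽
    open Configuration 𝔽 b b-indep p p-indep Ω∩Π≡∅ l l-indep Π∩ℓ≡0 (m≤n+m∸n n 2)
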